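{- For every integer $n\ge 0$, as polynomials in $x$, $$H_n(x)=\sum_{F\in\mathcal{F}(n)}\ \prod_{v\in V(F)}\frac{(2h_v-1)x+1-h_v}{h_v}=\frac{1}{2n+1}\binom{(2n+1)x}{n},$$ where $\binom{y}{n}=y(y-1)\cdots(y-n+1)/n!$.
   Context: A plane tree is a rooted tree with unlabelled vertices in which the children of each vertex are linearly ordered. A plane forest is a linearly ordered sequence of plane trees; $\mathcal{F}(n)$ is the set of plane forests with $n$ vertices in total ($\mathcal{F}(0)$ consists of the empty forest). $V(F)$ is the vertex set of $F$, and for $v\in V(F)$ the hook length $h_v$ is the number of vertices in the subtree rooted at $v$ (including $v$). The empty product is $1$, so $H_0(x)=1$. -}

module Defs where

open import Data.Nat as ℕ using (ℕ; zero; suc; _!)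
open import Data.Nat.Properties using (_!≢0)
open import Data.Integer using (+_)
open import Data.Rational using (ℚ; _+_; _*_; _-_; _/_; 0ℚ; 1ℚ)
open import Data.List using (List; []; _∷_)

data PlaneTree : Set where
  node : List PlaneTree → PlaneTree

PlaneForest : Set
PlaneForest = List PlaneTree

mutual
  treeSize : PlaneTree → ℕ
  treeSize (node ts) = suc (forestSize ts)

  forestSize : PlaneForest → ℕ
  forestSize [] = 0
  forestSize (t ∷ ts) = treeSize t ℕ.+ forestSize ts

ℕ→ℚ : ℕ → ℚ
ℕ→ℚ n = (+ n) / 1

-- the vertex weight ((2h-1)x + 1 - h)/h for hook length h = suc k
hookWeight : ℚ → ℕ → ℚ
hookWeight x k =
  ((ℕ→ℚ (2 ℕ.* h) - 1ℚ) * x + 1ℚ - ℕ→ℚ h) * ((+ 1) / h)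
  where h = suc k

-- product over all vertices v of the forest of hookWeight at h_v.
-- The root of (node ts) has hook length suc (forestSize ts).
mutual
  treeProd : ℚ → PlaneTree → ℚ
  treeProd x (node ts) = hookWeight x (forestSize ts) * forestProd x ts

  forestProd : ℚ → PlaneForest → ℚ
  forestProd x [] = 1ℚ
  forestProd x (t ∷ ts) = treeProd x t * forestProd x ts

sumOver : {A : Set} → (A → ℚ) → List A → ℚ
sumOver f [] = 0ℚ
sumOver f (a ∷ as) = f a + sumOver f as

falling : ℚ → ℕ → ℚ
falling y zero = 1ℚ
falling y (suc n) = falling y n * (y - ℕ→ℚ n)

gbinom : ℚ → ℕ → ℚ
gbinom y n = falling y n * (_/_ (+ 1) (n !) {{n !≢0}})

-- Splitting off the first tree gives H₀ = 1 and H_{m+1} = Σ_{k ≤ m} w_k H_k H_{m−k}, where w_k is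
-- the weight of a root of hook length k + 1. The Rothe numbers A_n(a) = a/(a + 2xn) · binom(a + 2xn, n)
-- satisfy the Rothe–Hagen identity Σ_k A_k(a) A_{n−k}(c) = A_n(a + c) and A_{k+1}(−x) = −w_k A_k(x);
-- at a = −x, c = x the right side vanishes, so A_n(x) obeys the same recurrence as H_n and equals it.
-- Rothe–Hagen holds because both sides are polynomials in a that change alike under a ↦ a + 1
-- (Pascal's rule), so their difference is a periodic polynomial, hence constant, and it vanishes at a = 0.
-- Finally A_n(x) = binom((2n + 1)x, n)/(2n + 1).

module Submission where

open import Defs
open import Data.Integer as ℤ using (+_; -[1+_])
import Data.Integer.Properties as ℤ
import Data.Integer.Tactic.RingSolver as ℤ-Solver
open import Data.List using (List; []; _∷_; _++_; map; cartesianProductWith)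
open import Data.List.Membership.Propositional using (_∈_)
open import Data.List.Membership.Propositional.Properties
  using (∈-++⁺ˡ; ∈-++⁺ʳ; ∈-++⁻; ∈-cartesianProductWith⁺; ∈-cartesianProductWith⁻)
open import Data.List.Membership.Propositional.Properties.WithK using (unique∧set⇒bag)
open import Data.List.Relation.Binary.BagAndSetEquality using (∼bag⇒↭)
open import Data.List.Relation.Binary.Permutation.Propositional as ↭ using (_↭_)
import Data.List.Relation.Unary.All as All
import Data.List.Relation.Unary.AllPairs as AllPairs
open import Data.List.Relation.Unary.Any using (here; there)
open import Data.List.Relation.Unary.Unique.Propositional using (Unique)
import Data.List.Relation.Unary.Unique.Propositional.Properties as Unique
open import Data.Nat as ℕ using (ℕ; zero; suc; z≤n; s≤s; _∸_; _!; NonZero)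
open import Data.Nat.Properties as ℕ using (_!≢0)
open import Data.Product using (∃-syntax; ∃₂; _×_; _,_; proj₁)
open import Data.Rational using (ℚ; mkℚ; _+_; _*_; _-_; -_; _/_; 0ℚ; 1ℚ; ↥_; ↧ₙ_; toℚᵘ)
open import Data.Rational.Properties
open import Data.Rational.Unnormalised as ℚᵘ using (mkℚᵘ; *≡*) renaming (_≃_ to _≃ᵘ_)
import Data.Rational.Unnormalised.Properties as ℚᵘ
open import Data.Sum using (inj₁; inj₂)
open import Function using (_∘_)
open import Function.Bundles using (_⇔_; mk⇔)
import Function.Properties.Equivalence as ⇔
open import Level using (0ℓ)
open import Relation.Binary.PropositionalEquality
open import Relation.Nullary using (¬_)
open import Relation.Nullary.Decidable using (dec⇒maybe)
open import Tactic.RingSolver using (solve-∀)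
open import Tactic.RingSolver.Core.AlmostCommutativeRing using (AlmostCommutativeRing; fromCommutativeRing)

ℚ-ring : AlmostCommutativeRing 0ℓ 0ℓ
ℚ-ring = fromCommutativeRing +-*-commutativeRing (λ p → dec⇒maybe (0ℚ ≟ p))

toℚᵘ-ℕ→ℚ : ∀ n → toℚᵘ (ℕ→ℚ n) ≃ᵘ mkℚᵘ (+ n) 0
toℚᵘ-ℕ→ℚ n = toℚᵘ-fromℚᵘ (mkℚᵘ (+ n) 0)

ℕ→ℚ-+ : ∀ m n → ℕ→ℚ (m ℕ.+ n) ≡ ℕ→ℚ m + ℕ→ℚ n
ℕ→ℚ-+ m n = toℚᵘ-injective (begin
  toℚᵘ (ℕ→ℚ (m ℕ.+ n))              ≈⟨ toℚᵘ-ℕ→ℚ (m ℕ.+ n) ⟩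
  mkℚᵘ (+ (m ℕ.+ n)) 0              ≈⟨ *≡* (trans (cong (ℤ._* (+ 1 ℤ.* + 1)) (ℤ.pos-+ m n)) (unitDenominators (+ m) (+ n))) ⟩
  mkℚᵘ (+ m) 0 ℚᵘ.+ mkℚᵘ (+ n) 0    ≈⟨ ℚᵘ.+-cong (toℚᵘ-ℕ→ℚ m) (toℚᵘ-ℕ→ℚ n) ⟨
  toℚᵘ (ℕ→ℚ m) ℚᵘ.+ toℚᵘ (ℕ→ℚ n)    ≈⟨ toℚᵘ-homo-+ (ℕ→ℚ m) (ℕ→ℚ n) ⟨
  toℚᵘ (ℕ→ℚ m + ℕ→ℚ n)              ∎)
  where
  open ℚᵘ.≃-Reasoning
  unitDenominators : ∀ a b → (a ℤ.+ b) ℤ.* (+ 1 ℤ.* + 1) ≡ (a ℤ.* + 1 ℤ.+ b ℤ.* + 1) ℤ.* + 1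
  unitDenominators = ℤ-Solver.solve-∀

ℕ→ℚ-* : ∀ m n → ℕ→ℚ (m ℕ.* n) ≡ ℕ→ℚ m * ℕ→ℚ n
ℕ→ℚ-* m n = toℚᵘ-injective (begin
  toℚᵘ (ℕ→ℚ (m ℕ.* n))              ≈⟨ toℚᵘ-ℕ→ℚ (m ℕ.* n) ⟩
  mkℚᵘ (+ (m ℕ.* n)) 0              ≈⟨ *≡* (trans (cong (ℤ._* (+ 1 ℤ.* + 1)) (ℤ.pos-* m n)) (unitDenominators (+ m) (+ n))) ⟩
  mkℚᵘ (+ m) 0 ℚᵘ.* mkℚᵘ (+ n) 0    ≈⟨ ℚᵘ.*-cong (toℚᵘ-ℕ→ℚ m) (toℚᵘ-ℕ→ℚ n) ⟨
  toℚᵘ (ℕ→ℚ m) ℚᵘ.* toℚᵘ (ℕ→ℚ n)    ≈⟨ toℚᵘ-homo-* (ℕ→ℚ m) (ℕ→ℚ n) ⟨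
  toℚᵘ (ℕ→ℚ m * ℕ→ℚ n)              ∎)
  where
  open ℚᵘ.≃-Reasoning
  unitDenominators : ∀ a b → (a ℤ.* b) ℤ.* (+ 1 ℤ.* + 1) ≡ (a ℤ.* b) ℤ.* + 1
  unitDenominators = ℤ-Solver.solve-∀

ℕ→ℚ-suc : ∀ n → ℕ→ℚ (suc n) ≡ 1ℚ + ℕ→ℚ n
ℕ→ℚ-suc = ℕ→ℚ-+ 1

ℕ→ℚ-2+ : ∀ j → ℕ→ℚ (suc (suc j)) ≡ 1ℚ + (1ℚ + ℕ→ℚ j)
ℕ→ℚ-2+ j = trans (ℕ→ℚ-suc (suc j)) (cong (λ z → 1ℚ + z) (ℕ→ℚ-suc j))

ℕ→ℚ-double : ∀ h → ℕ→ℚ (2 ℕ.* h) ≡ ℕ→ℚ h + ℕ→ℚ h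
ℕ→ℚ-double h = trans (ℕ→ℚ-+ h (h ℕ.+ 0)) (cong (λ z → ℕ→ℚ h + ℕ→ℚ z) (ℕ.+-identityʳ h))

ℕ→ℚ-inverseʳ : ∀ n .{{_ : NonZero n}} → ℕ→ℚ n * ((+ 1) / n) ≡ 1ℚ
ℕ→ℚ-inverseʳ (suc k) = toℚᵘ-injective (begin
  toℚᵘ (ℕ→ℚ (suc k) * ((+ 1) / suc k))               ≈⟨ toℚᵘ-homo-* (ℕ→ℚ (suc k)) ((+ 1) / suc k) ⟩
  toℚᵘ (ℕ→ℚ (suc k)) ℚᵘ.* toℚᵘ ((+ 1) / suc k)      ≈⟨ ℚᵘ.*-cong (toℚᵘ-ℕ→ℚ (suc k)) (toℚᵘ-fromℚᵘ (mkℚᵘ (+ 1) k)) ⟩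
  mkℚᵘ (+ suc k) 0 ℚᵘ.* mkℚᵘ (+ 1) k                 ≈⟨ *≡* (cancel (+ suc k)) ⟩
  toℚᵘ 1ℚ                                             ∎)
  where
  open ℚᵘ.≃-Reasoning
  cancel : ∀ a → (a ℤ.* + 1) ℤ.* + 1 ≡ + 1 ℤ.* (+ 1 ℤ.* a)
  cancel = ℤ-Solver.solve-∀

ℕ→ℚ-↧*≡↥ : ∀ q → ℕ→ℚ (↧ₙ q) * q ≡ (↥ q) / 1
ℕ→ℚ-↧*≡↥ q@(mkℚ n d _) = toℚᵘ-injective (begin
  toℚᵘ (ℕ→ℚ (suc d) * q)               ≈⟨ toℚᵘ-homo-* (ℕ→ℚ (suc d)) q ⟩
  toℚᵘ (ℕ→ℚ (suc d)) ℚᵘ.* toℚᵘ q       ≈⟨ ℚᵘ.*-congʳ (toℚᵘ-ℕ→ℚ (suc d)) ⟩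
  mkℚᵘ (+ suc d) 0 ℚᵘ.* mkℚᵘ n d       ≈⟨ *≡* (cancel (+ suc d) n) ⟩
  mkℚᵘ n 0                              ≈⟨ toℚᵘ-fromℚᵘ (mkℚᵘ n 0) ⟨
  toℚᵘ (n / 1)                          ∎)
  where
  open ℚᵘ.≃-Reasoning
  cancel : ∀ a b → (a ℤ.* b) ℤ.* + 1 ≡ b ℤ.* (+ 1 ℤ.* a)
  cancel = ℤ-Solver.solve-∀

*-cancelˡ-ℕ→ℚ : ∀ n .{{_ : NonZero n}} {p q} → ℕ→ℚ n * p ≡ ℕ→ℚ n * q → p ≡ q
*-cancelˡ-ℕ→ℚ n {p} {q} np≡nq = begin
  p                  ≡⟨ unscale p ⟨
  n⁻¹ * (ℕ→ℚ n * p)  ≡⟨ cong (n⁻¹ *_) np≡nq ⟩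
  n⁻¹ * (ℕ→ℚ n * q)  ≡⟨ unscale q ⟩
  q                  ∎
  where
  open ≡-Reasoning
  n⁻¹ = (+ 1) / n
  unscale : ∀ r → n⁻¹ * (ℕ→ℚ n * r) ≡ r
  unscale r = begin
    n⁻¹ * (ℕ→ℚ n * r)  ≡⟨ *-assoc n⁻¹ (ℕ→ℚ n) r ⟨
    n⁻¹ * ℕ→ℚ n * r    ≡⟨ cong (_* r) (trans (*-comm n⁻¹ (ℕ→ℚ n)) (ℕ→ℚ-inverseʳ n)) ⟩
    1ℚ * r             ≡⟨ *-identityˡ r ⟩
    r                  ∎

-- Polynomial functions on ℚ

Δ : ℚ → (ℚ → ℚ) → ℚ → ℚ
Δ h f a = f (a + h) - f a

-- Degree≤ d f: f is a polynomial function of degree ≤ d, i.e. its (d + 1)-st differences vanish.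
data Degree≤ : ℕ → (ℚ → ℚ) → Set where
  constant    : ∀ {f} → (∀ a → f a ≡ f 0ℚ) → Degree≤ zero f
  differences : ∀ {d f} → (∀ h → Degree≤ d (Δ h f)) → Degree≤ (suc d) f

Degree≤-cong : ∀ {d f g} → (∀ a → f a ≡ g a) → Degree≤ d f → Degree≤ d g
Degree≤-cong f≗g (constant p) = constant (λ a → trans (sym (f≗g a)) (trans (p a) (f≗g 0ℚ)))
Degree≤-cong f≗g (differences p) = differences (λ h → Degree≤-cong (λ a → cong₂ _-_ (f≗g (a + h)) (f≗g a)) (p h))

Degree≤-const : ∀ d c → Degree≤ d (λ _ → c)
Degree≤-const zero c = constant (λ _ → refl)
Degree≤-const (suc d) c = differences (λ _ → Degree≤-cong (λ _ → sym (+-inverseʳ c)) (Degree≤-const d 0ℚ))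

Degree≤-+ : ∀ {d f g} → Degree≤ d f → Degree≤ d g → Degree≤ d (λ a → f a + g a)
Degree≤-+ (constant p) (constant q) = constant (λ a → cong₂ _+_ (p a) (q a))
Degree≤-+ {f = f} {g} (differences p) (differences q) = differences (λ h →
  Degree≤-cong (λ a → interchange (f (a + h)) (f a) (g (a + h)) (g a)) (Degree≤-+ (p h) (q h)))
  where
  interchange : ∀ w x y z → (w - x) + (y - z) ≡ (w + y) - (x + z)
  interchange = solve-∀ ℚ-ring

Degree≤-*ʳ : ∀ {d f} c → Degree≤ d f → Degree≤ d (λ a → f a * c)
Degree≤-*ʳ c (constant p) = constant (λ a → cong (_* c) (p a))
Degree≤-*ʳ {f = f} c (differences p) = differences (λ h →
  Degree≤-cong (λ a → distrib (f (a + h)) (f a) c) (Degree≤-*ʳ c (p h)))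
  where
  distrib : ∀ w x c → (w - x) * c ≡ w * c - x * c
  distrib = solve-∀ ℚ-ring

Degree≤-- : ∀ {d f g} → Degree≤ d f → Degree≤ d g → Degree≤ d (λ a → f a - g a)
Degree≤-- {f = f} {g} p q = Degree≤-cong (λ a → sym (sub≡+*-1 (f a) (g a))) (Degree≤-+ p (Degree≤-*ʳ (- 1ℚ) q))
  where
  sub≡+*-1 : ∀ x y → x - y ≡ x + y * (- 1ℚ)
  sub≡+*-1 = solve-∀ ℚ-ring

Degree≤-suc : ∀ {d f} → Degree≤ d f → Degree≤ (suc d) f
Degree≤-suc (constant p) = differences (λ h → constant (λ a →
  cong₂ _-_ (trans (p (a + h)) (sym (p (0ℚ + h)))) (trans (p a) (sym (p 0ℚ)))))
Degree≤-suc (differences p) = differences (λ h → Degree≤-suc (p h))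

Degree≤-mono : ∀ {d e f} → d ℕ.≤ e → Degree≤ d f → Degree≤ e f
Degree≤-mono {e = zero} z≤n p = p
Degree≤-mono {e = suc e} z≤n p = Degree≤-suc (Degree≤-mono z≤n p)
Degree≤-mono (s≤s d≤e) (differences p) = differences (λ h → Degree≤-mono d≤e (p h))

Degree≤-translate : ∀ {d f} c → Degree≤ d f → Degree≤ d (λ a → f (a + c))
Degree≤-translate c (constant p) = constant (λ a → trans (p (a + c)) (sym (p (0ℚ + c))))
Degree≤-translate {f = f} c (differences p) = differences (λ h →
  Degree≤-cong (λ a → cong (λ z → f z - f (a + c)) (swap a c h)) (Degree≤-translate c (p h)))
  where
  swap : ∀ a c h → a + c + h ≡ a + h + c
  swap = solve-∀ ℚ-ring

Degree≤-*-linear : ∀ {d f} α β → Degree≤ d f → Degree≤ (suc d) (λ a → f a * (α * a + β))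
Degree≤-*-linear {f = f} α β p = differences (λ h →
  Degree≤-cong (λ a → product-rule (f (a + h)) (f a) α β a h)
    (Degree≤-+ (Δf*linear h p) (Degree≤-*ʳ (α * h) p)))
  where
  product-rule : ∀ u v α β a h →
    (u - v) * (α * a + (α * h + β)) + v * (α * h) ≡ u * (α * (a + h) + β) - v * (α * a + β)
  product-rule = solve-∀ ℚ-ring
  Δf*linear : ∀ {d f} h → Degree≤ d f → Degree≤ d (λ a → Δ h f a * (α * a + (α * h + β)))
  Δf*linear {f = f} h (constant p) = Degree≤-cong (λ a → sym (vanishes a)) (Degree≤-const zero 0ℚ)
    where
    vanishes : ∀ a → Δ h f a * (α * a + (α * h + β)) ≡ 0ℚ
    vanishes a = trans (cong (_* (α * a + (α * h + β))) (trans (cong₂ _-_ (p (a + h)) (p a)) (+-inverseʳ (f 0ℚ))))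
                       (*-zeroˡ (α * a + (α * h + β)))
  Δf*linear h (differences p) = Degree≤-*-linear α (α * h + β) (p h)

module _ (φ : ℚ → ℚ) (φ-+ : ∀ p q → φ (p + q) ≡ φ p + φ q) where

  additive-0 : φ 0ℚ ≡ 0ℚ
  additive-0 = begin
    φ 0ℚ                  ≡⟨ x≡[x+x]-x (φ 0ℚ) ⟩
    (φ 0ℚ + φ 0ℚ) - φ 0ℚ  ≡⟨ cong (_- φ 0ℚ) (φ-+ 0ℚ 0ℚ) ⟨
    φ 0ℚ - φ 0ℚ           ≡⟨ +-inverseʳ (φ 0ℚ) ⟩
    0ℚ                    ∎
    where
    open ≡-Reasoning
    x≡[x+x]-x : ∀ x → x ≡ (x + x) - x
    x≡[x+x]-x = solve-∀ ℚ-ring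

  additive-neg : ∀ q → φ (- q) ≡ - φ q
  additive-neg q = begin
    φ (- q)                   ≡⟨ y≡[x+y]-x (φ q) (φ (- q)) ⟩
    (φ q + φ (- q)) - φ q     ≡⟨ cong (_- φ q) (φ-+ q (- q)) ⟨
    φ (q - q) - φ q           ≡⟨ cong (λ z → φ z - φ q) (+-inverseʳ q) ⟩
    φ 0ℚ - φ q                ≡⟨ cong (_- φ q) additive-0 ⟩
    0ℚ - φ q                  ≡⟨ +-identityˡ (- φ q) ⟩
    - φ q                     ∎
    where
    open ≡-Reasoning
    y≡[x+y]-x : ∀ x y → y ≡ (x + y) - x
    y≡[x+y]-x = solve-∀ ℚ-ring

  additive-ℕ→ℚ* : ∀ k q → φ (ℕ→ℚ k * q) ≡ ℕ→ℚ k * φ q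
  additive-ℕ→ℚ* zero q = trans (cong φ (*-zeroˡ q)) (trans additive-0 (sym (*-zeroˡ (φ q))))
  additive-ℕ→ℚ* (suc k) q = begin
    φ (ℕ→ℚ (suc k) * q)       ≡⟨ cong φ (trans (cong (_* q) (ℕ→ℚ-suc k)) (unfold (ℕ→ℚ k) q)) ⟩
    φ (q + ℕ→ℚ k * q)         ≡⟨ φ-+ q (ℕ→ℚ k * q) ⟩
    φ q + φ (ℕ→ℚ k * q)       ≡⟨ cong (λ z → φ q + z) (additive-ℕ→ℚ* k q) ⟩
    φ q + ℕ→ℚ k * φ q         ≡⟨ trans (cong (_* φ q) (ℕ→ℚ-suc k)) (unfold (ℕ→ℚ k) (φ q)) ⟨
    ℕ→ℚ (suc k) * φ q         ∎
    where
    open ≡-Reasoning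
    unfold : ∀ n q → (1ℚ + n) * q ≡ q + n * q
    unfold = solve-∀ ℚ-ring

  additive∧1↦0⇒0 : φ 1ℚ ≡ 0ℚ → ∀ q → φ q ≡ 0ℚ
  additive∧1↦0⇒0 φ1≡0 q@(mkℚ _ d _) = *-cancelˡ-ℕ→ℚ (suc d) (begin
    ℕ→ℚ (suc d) * φ q        ≡⟨ additive-ℕ→ℚ* (suc d) q ⟨
    φ (ℕ→ℚ (suc d) * q)      ≡⟨ cong φ (ℕ→ℚ-↧*≡↥ q) ⟩
    φ ((↥ q) / 1)            ≡⟨ φ-integer (↥ q) ⟩
    0ℚ                       ≡⟨ *-zeroʳ (ℕ→ℚ (suc d)) ⟨
    ℕ→ℚ (suc d) * 0ℚ         ∎)
    where
    open ≡-Reasoning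
    φ-ℕ : ∀ n → φ (ℕ→ℚ n) ≡ 0ℚ
    φ-ℕ n = begin
      φ (ℕ→ℚ n)           ≡⟨ cong φ (*-identityʳ (ℕ→ℚ n)) ⟨
      φ (ℕ→ℚ n * 1ℚ)      ≡⟨ additive-ℕ→ℚ* n 1ℚ ⟩
      ℕ→ℚ n * φ 1ℚ        ≡⟨ cong (ℕ→ℚ n *_) φ1≡0 ⟩
      ℕ→ℚ n * 0ℚ          ≡⟨ *-zeroʳ (ℕ→ℚ n) ⟩
      0ℚ                  ∎
    φ-integer : ∀ i → φ (i / 1) ≡ 0ℚ
    φ-integer (+ n) = φ-ℕ n
    φ-integer -[1+ n ] = trans (additive-neg (ℕ→ℚ (suc n))) (cong -_ (φ-ℕ (suc n)))

-- Each difference Δ h f is periodic of lower degree, hence constant by induction, so f − f 0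
-- is additive on ℚ and vanishes at 1.
Degree≤∧periodic⇒constant : ∀ {d f} → Degree≤ d f → (∀ a → f (a + 1ℚ) ≡ f a) → ∀ a → f a ≡ f 0ℚ
Degree≤∧periodic⇒constant (constant p) _ = p
Degree≤∧periodic⇒constant {f = f} (differences p) periodic a = begin
  f a               ≡⟨ x≡[x-y]+y (f a) (f 0ℚ) ⟩
  φ a + f 0ℚ        ≡⟨ cong (_+ f 0ℚ) (additive∧1↦0⇒0 φ φ-+ φ-1 a) ⟩
  0ℚ + f 0ℚ         ≡⟨ +-identityˡ (f 0ℚ) ⟩
  f 0ℚ              ∎
  where
  open ≡-Reasoning
  x≡[x-y]+y : ∀ x y → x ≡ (x - y) + y
  x≡[x-y]+y = solve-∀ ℚ-ring
  φ : ℚ → ℚ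
  φ h = f h - f 0ℚ
  increment : ∀ a h → f (a + h) - f a ≡ φ h
  increment a h = trans
    (Degree≤∧periodic⇒constant (p h)
      (λ b → trans (cong (λ z → f z - f (b + 1ℚ)) (swap b h)) (cong₂ _-_ (periodic (b + h)) (periodic b))) a)
    (cong (λ z → f z - f 0ℚ) (+-identityˡ h))
    where
    swap : ∀ b h → b + 1ℚ + h ≡ b + h + 1ℚ
    swap = solve-∀ ℚ-ring
  φ-+ : ∀ a h → φ (a + h) ≡ φ a + φ h
  φ-+ a h = begin
    f (a + h) - f 0ℚ                 ≡⟨ telescope (f (a + h)) (f a) (f 0ℚ) ⟩
    (f (a + h) - f a) + (f a - f 0ℚ) ≡⟨ cong (_+ φ a) (increment a h) ⟩
    φ h + φ a                        ≡⟨ +-comm (φ h) (φ a) ⟩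
    φ a + φ h                        ∎
    where
    telescope : ∀ u v w → u - w ≡ (u - v) + (v - w)
    telescope = solve-∀ ℚ-ring
  φ-1 : φ 1ℚ ≡ 0ℚ
  φ-1 = trans (cong (_- f 0ℚ) (periodic 0ℚ)) (+-inverseʳ (f 0ℚ))

-- Convolution and the Rothe–Hagen identity

-- conv f g n = Σ_{k ≤ n} f k * g (n ∸ k)
conv : (ℕ → ℚ) → (ℕ → ℚ) → ℕ → ℚ
conv f g zero = f 0 * g 0
conv f g (suc n) = f 0 * g (suc n) + conv (f ∘ suc) g n

conv-cong : ∀ n {f f′ g g′} → (∀ k → k ℕ.≤ n → f k ≡ f′ k) → (∀ k → k ℕ.≤ n → g k ≡ g′ k) →
            conv f g n ≡ conv f′ g′ n
conv-cong zero f≗f′ g≗g′ = cong₂ _*_ (f≗f′ 0 z≤n) (g≗g′ 0 z≤n)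
conv-cong (suc n) f≗f′ g≗g′ = cong₂ _+_
  (cong₂ _*_ (f≗f′ 0 z≤n) (g≗g′ (suc n) ℕ.≤-refl))
  (conv-cong n (λ k k≤n → f≗f′ (suc k) (s≤s k≤n)) (λ k k≤n → g≗g′ k (ℕ.m≤n⇒m≤1+n k≤n)))

conv-+ˡ : ∀ n f f′ g → conv (λ k → f k + f′ k) g n ≡ conv f g n + conv f′ g n
conv-+ˡ zero f f′ g = *-distribʳ-+ (g 0) (f 0) (f′ 0)
conv-+ˡ (suc n) f f′ g = trans
  (cong (λ z → (f 0 + f′ 0) * g (suc n) + z) (conv-+ˡ n (f ∘ suc) (f′ ∘ suc) g))
  (interchange (f 0) (f′ 0) (g (suc n)) (conv (f ∘ suc) g n) (conv (f′ ∘ suc) g n))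
  where
  interchange : ∀ x y z u v → (x + y) * z + (u + v) ≡ (x * z + u) + (y * z + v)
  interchange = solve-∀ ℚ-ring

conv-negˡ : ∀ n f g → conv (λ k → - f k) g n ≡ - conv f g n
conv-negˡ zero f g = sym (neg-distribˡ-* (f 0) (g 0))
conv-negˡ (suc n) f g = trans
  (cong (λ z → - f 0 * g (suc n) + z) (conv-negˡ n (f ∘ suc) g))
  (neg-out (f 0) (g (suc n)) (conv (f ∘ suc) g n))
  where
  neg-out : ∀ x y z → - x * y + - z ≡ - (x * y + z)
  neg-out = solve-∀ ℚ-ring

conv-zeroˡ : ∀ n g → conv (λ _ → 0ℚ) g n ≡ 0ℚ
conv-zeroˡ zero g = *-zeroˡ (g 0)
conv-zeroˡ (suc n) g = cong₂ _+_ (*-zeroˡ (g (suc n))) (conv-zeroˡ n g)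

Degree≤-conv : ∀ n d (f : ℚ → ℕ → ℚ) g → (∀ k → Degree≤ (d ℕ.+ k) (λ a → f a k)) →
               Degree≤ (d ℕ.+ n) (λ a → conv (f a) g n)
Degree≤-conv zero d f g deg = Degree≤-*ʳ (g 0) (deg 0)
Degree≤-conv (suc n) d f g deg = Degree≤-+
  (Degree≤-mono (ℕ.+-monoʳ-≤ d z≤n) (Degree≤-*ʳ (g (suc n)) (deg 0)))
  (Degree≤-mono (ℕ.≤-reflexive (sym (ℕ.+-suc d n)))
    (Degree≤-conv n (suc d) (λ a → f a ∘ suc) g
      (λ k → Degree≤-mono (ℕ.≤-reflexive (ℕ.+-suc d k)) (deg (suc k)))))

falling-+1 : ∀ y j → falling (y + 1ℚ) (suc j) ≡ (y + 1ℚ) * falling y j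
falling-+1 y zero = trans (*-identityˡ (y + 1ℚ - 0ℚ)) (trans (+-identityʳ (y + 1ℚ)) (sym (*-identityʳ (y + 1ℚ))))
falling-+1 y (suc j) = begin
  falling (y + 1ℚ) (suc j) * (y + 1ℚ - ℕ→ℚ (suc j))    ≡⟨ cong₂ (λ u v → u * (y + 1ℚ - v)) (falling-+1 y j) (ℕ→ℚ-suc j) ⟩
  (y + 1ℚ) * falling y j * (y + 1ℚ - (1ℚ + ℕ→ℚ j))    ≡⟨ reassociate y (falling y j) (ℕ→ℚ j) ⟩
  (y + 1ℚ) * (falling y j * (y - ℕ→ℚ j))              ∎
  where
  open ≡-Reasoning
  reassociate : ∀ y F j → (y + 1ℚ) * F * (y + 1ℚ - (1ℚ + j)) ≡ (y + 1ℚ) * (F * (y - j))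
  reassociate = solve-∀ ℚ-ring

Degree≤-falling : ∀ m → Degree≤ m (λ a → falling a m)
Degree≤-falling zero = Degree≤-const zero 1ℚ
Degree≤-falling (suc m) =
  Degree≤-cong (λ a → cong (λ z → falling a m * (z - ℕ→ℚ m)) (*-identityˡ a))
    (Degree≤-*-linear 1ℚ (- ℕ→ℚ m) (Degree≤-falling m))

invFactorial : ℕ → ℚ
invFactorial zero = 1ℚ
invFactorial (suc n) = invFactorial n * ((+ 1) / suc n)

ℕ→ℚ-!*invFactorial : ∀ n → ℕ→ℚ (n !) * invFactorial n ≡ 1ℚ
ℕ→ℚ-!*invFactorial zero = refl
ℕ→ℚ-!*invFactorial (suc n) = begin
  ℕ→ℚ (suc n ℕ.* n !) * (invFactorial n * r)            ≡⟨ cong (_* (invFactorial n * r)) (ℕ→ℚ-* (suc n) (n !)) ⟩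
  ℕ→ℚ (suc n) * ℕ→ℚ (n !) * (invFactorial n * r)        ≡⟨ regroup (ℕ→ℚ (suc n)) (ℕ→ℚ (n !)) (invFactorial n) r ⟩
  (ℕ→ℚ (n !) * invFactorial n) * (ℕ→ℚ (suc n) * r)      ≡⟨ cong₂ _*_ (ℕ→ℚ-!*invFactorial n) (ℕ→ℚ-inverseʳ (suc n)) ⟩
  1ℚ * 1ℚ                                               ≡⟨ *-identityˡ 1ℚ ⟩
  1ℚ                                                    ∎
  where
  open ≡-Reasoning
  r = (+ 1) / suc n
  regroup : ∀ a b c d → a * b * (c * d) ≡ (b * c) * (a * d)
  regroup = solve-∀ ℚ-ring

invFactorial≡1/n! : ∀ n → invFactorial n ≡ _/_ (+ 1) (n !) {{n !≢0}}
invFactorial≡1/n! n = *-cancelˡ-ℕ→ℚ (n !) {{n !≢0}}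
  (trans (ℕ→ℚ-!*invFactorial n) (sym (ℕ→ℚ-inverseʳ (n !) {{n !≢0}})))

module Rothe (b : ℚ) where

  -- rothe a n = a / (a + b n) · binom(a + b n, n), with the division cancelled.
  rothe : ℚ → ℕ → ℚ
  rothe a zero = 1ℚ
  rothe a (suc m) = a * falling (a + b * ℕ→ℚ (suc m) - 1ℚ) m * invFactorial (suc m)

  rothe-0 : ∀ m → rothe 0ℚ (suc m) ≡ 0ℚ
  rothe-0 m = trans (cong (_* invFactorial (suc m)) (*-zeroˡ (falling (0ℚ + b * ℕ→ℚ (suc m) - 1ℚ) m))) (*-zeroˡ (invFactorial (suc m)))

  rothe-pascal : ∀ a m → rothe (a + 1ℚ) (suc m) ≡ rothe a (suc m) + rothe (a + b) m
  rothe-pascal a zero = base a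
    where
    base : ∀ a → (a + 1ℚ) * 1ℚ * (1ℚ * 1ℚ) ≡ a * 1ℚ * (1ℚ * 1ℚ) + 1ℚ
    base = solve-∀ ℚ-ring
  rothe-pascal a (suc j) = begin
    rothe (a + 1ℚ) (suc (suc j))
      ≡⟨ cong (λ z → (a + 1ℚ) * z * (I * R)) (trans (cong (λ w → falling w (suc j)) (shift a b K)) (falling-+1 Y j)) ⟩
    (a + 1ℚ) * ((Y + 1ℚ) * F) * (I * R)
      ≡⟨ pascal-identity a b (ℕ→ℚ j) F I R K (ℕ→ℚ-2+ j) ⟩
    a * (F * (Y - ℕ→ℚ j)) * (I * R) + (a + b) * F * (I * (K * R))
      ≡⟨ cong (λ z → rothe a (suc (suc j)) + (a + b) * F * z) (trans (cong (I *_) (ℕ→ℚ-inverseʳ (suc (suc j)))) (*-identityʳ I)) ⟩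
    rothe a (suc (suc j)) + (a + b) * F * I
      ≡⟨ cong (λ w → rothe a (suc (suc j)) + (a + b) * falling w j * I) shift′ ⟨
    rothe a (suc (suc j)) + rothe (a + b) (suc j)
      ∎
    where
    open ≡-Reasoning
    K = ℕ→ℚ (suc (suc j))
    Y = a + b * K - 1ℚ
    F = falling Y j
    I = invFactorial (suc j)
    R = (+ 1) / suc (suc j)
    shift : ∀ a b K → a + 1ℚ + b * K - 1ℚ ≡ (a + b * K - 1ℚ) + 1ℚ
    shift = solve-∀ ℚ-ring
    shift′ : a + b + b * ℕ→ℚ (suc j) - 1ℚ ≡ Y
    shift′ = trans (factor a b (ℕ→ℚ (suc j))) (cong (λ z → a + b * z - 1ℚ) (sym (ℕ→ℚ-suc (suc j))))
      where
      factor : ∀ a b m → a + b + b * m - 1ℚ ≡ a + b * (1ℚ + m) - 1ℚ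
      factor = solve-∀ ℚ-ring
    -- K = 2 + j is a hypothesis, matched by refl, so that the ring solver sees it.
    pascal-identity : ∀ a b j F I R K → K ≡ 1ℚ + (1ℚ + j) →
      (a + 1ℚ) * ((a + b * K - 1ℚ + 1ℚ) * F) * (I * R)
        ≡ a * (F * (a + b * K - 1ℚ - j)) * (I * R) + (a + b) * F * (I * (K * R))
    pascal-identity a b j F I R _ refl = identity a b j F I R
      where
      identity : ∀ a b j F I R →
        (a + 1ℚ) * ((a + b * (1ℚ + (1ℚ + j)) - 1ℚ + 1ℚ) * F) * (I * R)
          ≡ a * (F * (a + b * (1ℚ + (1ℚ + j)) - 1ℚ - j)) * (I * R) + (a + b) * F * (I * ((1ℚ + (1ℚ + j)) * R))
      identity = solve-∀ ℚ-ring

  Degree≤-rothe : ∀ m → Degree≤ m (λ a → rothe a m)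
  Degree≤-rothe zero = Degree≤-const zero 1ℚ
  Degree≤-rothe (suc m) =
    Degree≤-cong unfold
      (Degree≤-*ʳ (invFactorial (suc m))
        (Degree≤-*-linear 1ℚ 0ℚ (Degree≤-translate β (Degree≤-falling m))))
    where
    β = b * ℕ→ℚ (suc m) - 1ℚ
    commute : ∀ F a I → F * (1ℚ * a + 0ℚ) * I ≡ a * F * I
    commute = solve-∀ ℚ-ring
    unfold : ∀ a → falling (a + β) m * (1ℚ * a + 0ℚ) * invFactorial (suc m) ≡ rothe a (suc m)
    unfold a = trans (cong (λ z → falling z m * (1ℚ * a + 0ℚ) * invFactorial (suc m)) (sym (+-assoc a _ _)))
                     (commute _ a _)

  conv-rothe-+1 : ∀ m a g →
    conv (rothe (a + 1ℚ)) g (suc m) ≡ conv (rothe a) g (suc m) + conv (rothe (a + b)) g m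
  conv-rothe-+1 m a g = begin
    1ℚ * g (suc m) + conv (λ k → rothe (a + 1ℚ) (suc k)) g m
      ≡⟨ cong (λ z → 1ℚ * g (suc m) + z) (conv-cong m (λ k _ → rothe-pascal a k) (λ _ _ → refl)) ⟩
    1ℚ * g (suc m) + conv (λ k → rothe a (suc k) + rothe (a + b) k) g m
      ≡⟨ cong (λ z → 1ℚ * g (suc m) + z) (conv-+ˡ m (rothe a ∘ suc) (rothe (a + b)) g) ⟩
    1ℚ * g (suc m) + (conv (rothe a ∘ suc) g m + conv (rothe (a + b)) g m)
      ≡⟨ +-assoc (1ℚ * g (suc m)) _ _ ⟨
    conv (rothe a) g (suc m) + conv (rothe (a + b)) g m
      ∎
    where open ≡-Reasoning

  rothe-convolution : ∀ n a c → conv (rothe a) (rothe c) n ≡ rothe (a + c) n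
  rothe-convolution zero a c = *-identityˡ 1ℚ
  rothe-convolution (suc m) a c = begin
    conv (rothe a) (rothe c) (suc m)                  ≡⟨ x≡[x-y]+y _ (rothe (a + c) (suc m)) ⟩
    G a + rothe (a + c) (suc m)                       ≡⟨ cong (_+ rothe (a + c) (suc m)) (trans (G-constant a) G-0) ⟩
    0ℚ + rothe (a + c) (suc m)                        ≡⟨ +-identityˡ _ ⟩
    rothe (a + c) (suc m)                             ∎
    where
    open ≡-Reasoning
    x≡[x-y]+y : ∀ x y → x ≡ (x - y) + y
    x≡[x-y]+y = solve-∀ ℚ-ring
    G : ℚ → ℚ
    G a = conv (rothe a) (rothe c) (suc m) - rothe (a + c) (suc m)
    G-periodic : ∀ a → G (a + 1ℚ) ≡ G a
    G-periodic a = begin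
      L (a + 1ℚ) - R (a + 1ℚ)                                    ≡⟨ cong₂ _-_ L-step R-step ⟩
      (L a + rothe (a + b + c) m) - (R a + rothe (a + b + c) m)  ≡⟨ cancel (L a) (R a) (rothe (a + b + c) m) ⟩
      L a - R a                                                  ∎
      where
      L R : ℚ → ℚ
      L a = conv (rothe a) (rothe c) (suc m)
      R a = rothe (a + c) (suc m)
      swap : ∀ x y z → x + y + z ≡ x + z + y
      swap = solve-∀ ℚ-ring
      cancel : ∀ x y z → (x + z) - (y + z) ≡ x - y
      cancel = solve-∀ ℚ-ring
      L-step : L (a + 1ℚ) ≡ L a + rothe (a + b + c) m
      L-step = trans (conv-rothe-+1 m a (rothe c)) (cong (λ z → L a + z) (rothe-convolution m (a + b) c))
      R-step : R (a + 1ℚ) ≡ R a + rothe (a + b + c) m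
      R-step = trans (cong (λ z → rothe z (suc m)) (swap a 1ℚ c))
                     (trans (rothe-pascal (a + c) m) (cong (λ z → R a + rothe z m) (swap a c b)))
    Degree≤-G : Degree≤ (suc m) G
    Degree≤-G = Degree≤--
      (Degree≤-conv (suc m) 0 rothe (rothe c) Degree≤-rothe)
      (Degree≤-translate c (Degree≤-rothe (suc m)))
    G-constant : ∀ a → G a ≡ G 0ℚ
    G-constant = Degree≤∧periodic⇒constant Degree≤-G G-periodic
    G-0 : G 0ℚ ≡ 0ℚ
    G-0 = begin
      (1ℚ * rothe c (suc m) + conv (λ k → rothe 0ℚ (suc k)) (rothe c) m) - rothe (0ℚ + c) (suc m)
        ≡⟨ cong₂ (λ u v → (1ℚ * rothe c (suc m) + u) - rothe v (suc m))
                 (trans (conv-cong m (λ k _ → rothe-0 k) (λ _ _ → refl)) (conv-zeroˡ m (rothe c))) (+-identityˡ c) ⟩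
      (1ℚ * rothe c (suc m) + 0ℚ) - rothe c (suc m)
        ≡⟨ vanish (rothe c (suc m)) ⟩
      0ℚ ∎
      where
      vanish : ∀ y → (1ℚ * y + 0ℚ) - y ≡ 0ℚ
      vanish = solve-∀ ℚ-ring

module _ (x : ℚ) where
  open Rothe (x + x)

  rothe-neg : ∀ k → rothe (- x) (suc k) ≡ - (hookWeight x k * rothe x k)
  rothe-neg zero = hook-identity₀ x
    where
    hook-identity₀ : ∀ x → - x * 1ℚ * (1ℚ * 1ℚ) ≡ - (((1ℚ + 1ℚ - 1ℚ) * x + 1ℚ - 1ℚ) * 1ℚ * 1ℚ)
    hook-identity₀ = solve-∀ ℚ-ring
  rothe-neg (suc j) = begin
    - x * (falling Y j * (Y - ℕ→ℚ j)) * (I * R)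
      ≡⟨ hook-identity x (ℕ→ℚ j) (falling Y j) I R (ℕ→ℚ h) (ℕ→ℚ (2 ℕ.* h)) (ℕ→ℚ-2+ j) (ℕ→ℚ-double h) ⟩
    - (hookWeight x (suc j) * (x * falling Y j * I))
      ≡⟨ cong (λ z → - (hookWeight x (suc j) * (x * falling z j * I))) Y≡Y′ ⟨
    - (hookWeight x (suc j) * rothe x (suc j))
      ∎
    where
    open ≡-Reasoning
    h = suc (suc j)
    Y = - x + (x + x) * ℕ→ℚ h - 1ℚ
    I = invFactorial (suc j)
    R = (+ 1) / h
    Y≡Y′ : x + (x + x) * ℕ→ℚ (suc j) - 1ℚ ≡ Y
    Y≡Y′ = trans (shift x (ℕ→ℚ (suc j))) (cong (λ z → - x + (x + x) * z - 1ℚ) (sym (ℕ→ℚ-suc (suc j))))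
      where
      shift : ∀ x m → x + (x + x) * m - 1ℚ ≡ - x + (x + x) * (1ℚ + m) - 1ℚ
      shift = solve-∀ ℚ-ring
    hook-identity : ∀ x j F I R H D → H ≡ 1ℚ + (1ℚ + j) → D ≡ H + H →
      - x * (F * ((- x + (x + x) * H - 1ℚ) - j)) * (I * R) ≡ - (((D - 1ℚ) * x + 1ℚ - H) * R * (x * F * I))
    hook-identity x j F I R _ _ refl refl = identity x j F I R
      where
      identity : ∀ x j F I R →
        - x * (F * ((- x + (x + x) * (1ℚ + (1ℚ + j)) - 1ℚ) - j)) * (I * R)
          ≡ - ((((1ℚ + (1ℚ + j)) + (1ℚ + (1ℚ + j)) - 1ℚ) * x + 1ℚ - (1ℚ + (1ℚ + j))) * R * (x * F * I))
      identity = solve-∀ ℚ-ring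

  rothe-recurrence : ∀ m → rothe x (suc m) ≡ conv (λ k → hookWeight x k * rothe x k) (rothe x) m
  rothe-recurrence m = begin
    rothe x (suc m)                                 ≡⟨ y≡[1*y+-c]+c (rothe x (suc m)) C ⟩
    (1ℚ * rothe x (suc m) + - C) + C                ≡⟨ cong (λ z → (1ℚ * rothe x (suc m) + z) + C) tail≡-C ⟨
    conv (rothe (- x)) (rothe x) (suc m) + C        ≡⟨ cong (_+ C) (rothe-convolution (suc m) (- x) x) ⟩
    rothe (- x + x) (suc m) + C                     ≡⟨ cong (λ z → rothe z (suc m) + C) (+-inverseˡ x) ⟩
    rothe 0ℚ (suc m) + C                            ≡⟨ cong (_+ C) (rothe-0 m) ⟩
    0ℚ + C                                          ≡⟨ +-identityˡ C ⟩
    C                                               ∎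
    where
    open ≡-Reasoning
    C = conv (λ k → hookWeight x k * rothe x k) (rothe x) m
    y≡[1*y+-c]+c : ∀ y c → y ≡ (1ℚ * y + - c) + c
    y≡[1*y+-c]+c = solve-∀ ℚ-ring
    tail≡-C : conv (λ k → rothe (- x) (suc k)) (rothe x) m ≡ - C
    tail≡-C = trans (conv-cong m (λ k _ → rothe-neg k) (λ _ _ → refl))
                    (conv-negˡ m (λ k → hookWeight x k * rothe x k) (rothe x))

  rothe≡gbinom : ∀ n → rothe x n ≡ ((+ 1) / suc (2 ℕ.* n)) * gbinom (ℕ→ℚ (suc (2 ℕ.* n)) * x) n
  rothe≡gbinom zero = refl
  rothe≡gbinom n@(suc m) = sym (begin
    r * (falling Z n * (_/_ (+ 1) (n !) {{n !≢0}}))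
      ≡⟨ cong₂ (λ u v → r * (u * v)) (trans (cong (λ z → falling z n) (z≡z-1+1 Z)) (falling-+1 (Z - 1ℚ) m))
                                     (sym (invFactorial≡1/n! n)) ⟩
    r * ((Z - 1ℚ + 1ℚ) * falling (Z - 1ℚ) m * I)
      ≡⟨ cong (λ z → r * ((Z - 1ℚ + 1ℚ) * falling z m * I)) Z-1≡Y ⟩
    r * ((Z - 1ℚ + 1ℚ) * falling Y m * I)
      ≡⟨ regroup r S x (falling Y m) I ⟩
    (S * r) * (x * falling Y m * I)
      ≡⟨ cong (_* (x * falling Y m * I)) (ℕ→ℚ-inverseʳ (suc (2 ℕ.* n))) ⟩
    1ℚ * (x * falling Y m * I)
      ≡⟨ *-identityˡ _ ⟩
    rothe x n ∎)
    where
    open ≡-Reasoning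
    S = ℕ→ℚ (suc (2 ℕ.* n))
    Z = S * x
    r = (+ 1) / suc (2 ℕ.* n)
    Y = x + (x + x) * ℕ→ℚ n - 1ℚ
    I = invFactorial n
    z≡z-1+1 : ∀ z → z ≡ z - 1ℚ + 1ℚ
    z≡z-1+1 = solve-∀ ℚ-ring
    regroup : ∀ r s x F I → r * ((s * x - 1ℚ + 1ℚ) * F * I) ≡ (s * r) * (x * F * I)
    regroup = solve-∀ ℚ-ring
    expand : ∀ x m → (1ℚ + (m + m)) * x - 1ℚ ≡ x + (x + x) * m - 1ℚ
    expand = solve-∀ ℚ-ring
    Z-1≡Y : Z - 1ℚ ≡ Y
    Z-1≡Y = trans (cong (λ s → s * x - 1ℚ) (trans (ℕ→ℚ-suc (2 ℕ.* n)) (cong (λ z → 1ℚ + z) (ℕ→ℚ-double n))))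
                  (expand x (ℕ→ℚ n))

-- Plane forests of a given size

plant : PlaneForest → PlaneForest → PlaneForest
plant cs ts = node cs ∷ ts

plant-injective : ∀ {cs cs′ ts ts′} → plant cs ts ≡ plant cs′ ts′ → cs ≡ cs′ × ts ≡ ts′
plant-injective refl = refl , refl

-- plantings F G n lists plant cs ts for cs ∈ F k, ts ∈ G (n ∸ k), k ≤ n.
plantings : (ℕ → List PlaneForest) → (ℕ → List PlaneForest) → ℕ → List PlaneForest
plantings F G zero = cartesianProductWith plant (F 0) (G 0)
plantings F G (suc n) = cartesianProductWith plant (F 0) (G (suc n)) ++ plantings (F ∘ suc) G n

∈-plantings⁻ : ∀ F G n {z} → z ∈ plantings F G n →
  ∃[ k ] ∃₂ λ cs ts → k ℕ.≤ n × cs ∈ F k × ts ∈ G (n ∸ k) × z ≡ plant cs ts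
∈-plantings⁻ F G zero z∈ =
  let cs , ts , cs∈ , ts∈ , z≡ = ∈-cartesianProductWith⁻ plant (F 0) (G 0) z∈
  in 0 , cs , ts , z≤n , cs∈ , ts∈ , z≡
∈-plantings⁻ F G (suc n) z∈ with ∈-++⁻ (cartesianProductWith plant (F 0) (G (suc n))) z∈
... | inj₁ z∈₀ =
  let cs , ts , cs∈ , ts∈ , z≡ = ∈-cartesianProductWith⁻ plant (F 0) (G (suc n)) z∈₀
  in 0 , cs , ts , z≤n , cs∈ , ts∈ , z≡
... | inj₂ z∈₊ =
  let k , cs , ts , k≤n , cs∈ , ts∈ , z≡ = ∈-plantings⁻ (F ∘ suc) G n z∈₊
  in suc k , cs , ts , s≤s k≤n , cs∈ , ts∈ , z≡

∈-plantings⁺ : ∀ F G {n k cs ts} → k ℕ.≤ n → cs ∈ F k → ts ∈ G (n ∸ k) → plant cs ts ∈ plantings F G n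
∈-plantings⁺ F G {zero} z≤n cs∈ ts∈ = ∈-cartesianProductWith⁺ plant cs∈ ts∈
∈-plantings⁺ F G {suc n} z≤n cs∈ ts∈ = ∈-++⁺ˡ (∈-cartesianProductWith⁺ plant cs∈ ts∈)
∈-plantings⁺ F G {suc n} (s≤s k≤n) cs∈ ts∈ =
  ∈-++⁺ʳ (cartesianProductWith plant (F 0) (G (suc n))) (∈-plantings⁺ (F ∘ suc) G k≤n cs∈ ts∈)

plantings-unique : ∀ F G n d → (∀ k → Unique (F k)) → (∀ k → Unique (G k)) →
  (∀ k {cs} → cs ∈ F k → forestSize cs ≡ d ℕ.+ k) → Unique (plantings F G n)
plantings-unique F G zero d uF uG _ =
  Unique.cartesianProductWith⁺ plant plant-injective (uF 0) (uG 0)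
plantings-unique F G (suc n) d uF uG size = Unique.++⁺
  (Unique.cartesianProductWith⁺ plant plant-injective (uF 0) (uG (suc n)))
  (plantings-unique (F ∘ suc) G n (suc d) (uF ∘ suc) uG (λ k cs∈ → trans (size (suc k) cs∈) (ℕ.+-suc d k)))
  disjoint
  where
  disjoint : ∀ {z} → ¬ (z ∈ cartesianProductWith plant (F 0) (G (suc n)) × z ∈ plantings (F ∘ suc) G n)
  disjoint (z∈₀ , z∈₊) with ∈-cartesianProductWith⁻ plant (F 0) (G (suc n)) z∈₀ | ∈-plantings⁻ (F ∘ suc) G n z∈₊
  ... | cs , _ , cs∈ , _ , refl | k , cs′ , _ , _ , cs′∈ , _ , z≡ =
    ℕ.m≢1+m+n d (begin
      d                ≡⟨ ℕ.+-identityʳ d ⟨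
      d ℕ.+ 0          ≡⟨ size 0 cs∈ ⟨
      forestSize cs    ≡⟨ cong forestSize (proj₁ (plant-injective z≡)) ⟩
      forestSize cs′   ≡⟨ size (suc k) cs′∈ ⟩
      d ℕ.+ suc k      ≡⟨ ℕ.+-suc d k ⟩
      suc (d ℕ.+ k)    ∎)
    where open ≡-Reasoning

-- The first argument is fuel: forestsOfSize fuel n lists the forests of size n when n < fuel.
forestsOfSize : ℕ → ℕ → List PlaneForest
forestsOfSize zero _ = []
forestsOfSize (suc fuel) zero = [] ∷ []
forestsOfSize (suc fuel) (suc n) = plantings (forestsOfSize fuel) (forestsOfSize fuel) n

forestsOfSize-sound : ∀ fuel n {F} → F ∈ forestsOfSize fuel n → forestSize F ≡ n
forestsOfSize-sound (suc fuel) zero (here refl) = refl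
forestsOfSize-sound (suc fuel) (suc n) F∈ with ∈-plantings⁻ (forestsOfSize fuel) (forestsOfSize fuel) n F∈
... | k , cs , ts , k≤n , cs∈ , ts∈ , refl = cong suc (begin
  forestSize cs ℕ.+ forestSize ts  ≡⟨ cong₂ ℕ._+_ (forestsOfSize-sound fuel k cs∈) (forestsOfSize-sound fuel (n ∸ k) ts∈) ⟩
  k ℕ.+ (n ∸ k)                    ≡⟨ ℕ.m+[n∸m]≡n k≤n ⟩
  n                                ∎)
  where open ≡-Reasoning

forestsOfSize-complete : ∀ fuel F → forestSize F ℕ.< fuel → F ∈ forestsOfSize fuel (forestSize F)
forestsOfSize-complete (suc fuel) [] _ = here refl
forestsOfSize-complete (suc fuel) (node cs ∷ ts) (s≤s size<fuel) =
  ∈-plantings⁺ (forestsOfSize fuel) (forestsOfSize fuel) (ℕ.m≤m+n k l)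
    (forestsOfSize-complete fuel cs (ℕ.≤-<-trans (ℕ.m≤m+n k l) size<fuel))
    (subst (λ m → ts ∈ forestsOfSize fuel m) (sym (ℕ.m+n∸m≡n k l))
      (forestsOfSize-complete fuel ts (ℕ.≤-<-trans (ℕ.m≤n+m l k) size<fuel)))
  where
  k = forestSize cs
  l = forestSize ts

forestsOfSize-unique : ∀ fuel n → Unique (forestsOfSize fuel n)
forestsOfSize-unique zero n = AllPairs.[]
forestsOfSize-unique (suc fuel) zero = All.[] AllPairs.∷ AllPairs.[]
forestsOfSize-unique (suc fuel) (suc n) = plantings-unique _ _ n 0
  (forestsOfSize-unique fuel) (forestsOfSize-unique fuel) (λ k → forestsOfSize-sound fuel k)

∈-forestsOfSize⇔ : ∀ n {F} → F ∈ forestsOfSize (suc n) n ⇔ forestSize F ≡ n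
∈-forestsOfSize⇔ n = mk⇔ (forestsOfSize-sound (suc n) n) complete
  where
  complete : ∀ {F} → forestSize F ≡ n → F ∈ forestsOfSize (suc n) n
  complete {F} refl = forestsOfSize-complete (suc n) F (ℕ.n<1+n n)

-- Sums of hook-length weights

module _ {A : Set} (f : A → ℚ) where

  sumOver-++ : ∀ xs ys → sumOver f (xs ++ ys) ≡ sumOver f xs + sumOver f ys
  sumOver-++ [] ys = sym (+-identityˡ (sumOver f ys))
  sumOver-++ (x ∷ xs) ys = trans (cong (λ z → f x + z) (sumOver-++ xs ys)) (sym (+-assoc (f x) _ _))

  sumOver-↭ : ∀ {xs ys} → xs ↭ ys → sumOver f xs ≡ sumOver f ys
  sumOver-↭ ↭.refl = refl
  sumOver-↭ (↭.prep x p) = cong (λ z → f x + z) (sumOver-↭ p)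
  sumOver-↭ (↭.swap {ys = ys} x y p) = trans (cong (λ z → f x + (f y + z)) (sumOver-↭ p)) (left-comm (f x) (f y) (sumOver f ys))
    where
    left-comm : ∀ a b c → a + (b + c) ≡ b + (a + c)
    left-comm = solve-∀ ℚ-ring
  sumOver-↭ (↭.trans p q) = trans (sumOver-↭ p) (sumOver-↭ q)

sumOver-cartesianProductWith : ∀ {A B C : Set} (f : C → ℚ) (g : A → B → C) (u : A → ℚ) (v : B → ℚ) →
  (∀ a b → f (g a b) ≡ u a * v b) → ∀ xs ys → sumOver f (cartesianProductWith g xs ys) ≡ sumOver u xs * sumOver v ys
sumOver-cartesianProductWith f g u v split [] ys = sym (*-zeroˡ (sumOver v ys))
sumOver-cartesianProductWith f g u v split (x ∷ xs) ys = begin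
  sumOver f (map (g x) ys ++ cartesianProductWith g xs ys)         ≡⟨ sumOver-++ f (map (g x) ys) _ ⟩
  sumOver f (map (g x) ys) + sumOver f (cartesianProductWith g xs ys)
    ≡⟨ cong₂ _+_ (row ys) (sumOver-cartesianProductWith f g u v split xs ys) ⟩
  u x * sumOver v ys + sumOver u xs * sumOver v ys                ≡⟨ *-distribʳ-+ (sumOver v ys) (u x) _ ⟨
  (u x + sumOver u xs) * sumOver v ys                             ∎
  where
  open ≡-Reasoning
  row : ∀ ys → sumOver f (map (g x) ys) ≡ u x * sumOver v ys
  row [] = sym (*-zeroʳ (u x))
  row (y ∷ ys) = trans (cong₂ _+_ (split x y) (row ys)) (sym (*-distribˡ-+ (u x) (v y) (sumOver v ys)))

module _ (x : ℚ) where
  open Rothe (x + x)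

  private
    S : List PlaneForest → ℚ
    S = sumOver (forestProd x)

  sumOver-children : ∀ k L → (∀ {cs} → cs ∈ L → forestSize cs ≡ k) →
    sumOver (treeProd x ∘ node) L ≡ hookWeight x k * S L
  sumOver-children k [] _ = sym (*-zeroʳ (hookWeight x k))
  sumOver-children k (cs ∷ L) size = trans
    (cong₂ _+_ (cong (λ h → hookWeight x h * forestProd x cs) (size (here refl)))
               (sumOver-children k L (size ∘ there)))
    (sym (*-distribˡ-+ (hookWeight x k) (forestProd x cs) (S L)))

  sumOver-plant : ∀ k L₁ L₂ → (∀ {cs} → cs ∈ L₁ → forestSize cs ≡ k) →
    S (cartesianProductWith plant L₁ L₂) ≡ hookWeight x k * S L₁ * S L₂
  sumOver-plant k L₁ L₂ size = trans
    (sumOver-cartesianProductWith (forestProd x) plant (treeProd x ∘ node) (forestProd x) (λ _ _ → refl) L₁ L₂)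
    (cong (_* S L₂) (sumOver-children k L₁ size))

  sumOver-plantings : ∀ F G n d → (∀ k {cs} → cs ∈ F k → forestSize cs ≡ d ℕ.+ k) →
    S (plantings F G n) ≡ conv (λ k → hookWeight x (d ℕ.+ k) * S (F k)) (S ∘ G) n
  sumOver-plantings F G zero d size = sumOver-plant (d ℕ.+ 0) (F 0) (G 0) (size 0)
  sumOver-plantings F G (suc n) d size = trans
    (sumOver-++ (forestProd x) (cartesianProductWith plant (F 0) (G (suc n))) _)
    (cong₂ _+_ (sumOver-plant (d ℕ.+ 0) (F 0) (G (suc n)) (size 0))
      (trans (sumOver-plantings (F ∘ suc) G n (suc d) (λ k cs∈ → trans (size (suc k) cs∈) (ℕ.+-suc d k)))
        (conv-cong n (λ k _ → cong (λ h → hookWeight x h * S (F (suc k))) (sym (ℕ.+-suc d k))) (λ _ _ → refl))))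

  sumOver-forestsOfSize : ∀ fuel n → n ℕ.< fuel → S (forestsOfSize fuel n) ≡ rothe x n
  sumOver-forestsOfSize (suc fuel) zero _ = +-identityʳ 1ℚ
  sumOver-forestsOfSize (suc fuel) (suc m) (s≤s m<fuel) = begin
    S (plantings (forestsOfSize fuel) (forestsOfSize fuel) m)
      ≡⟨ sumOver-plantings (forestsOfSize fuel) (forestsOfSize fuel) m 0 (forestsOfSize-sound fuel) ⟩
    conv (λ k → hookWeight x k * S (forestsOfSize fuel k)) (S ∘ forestsOfSize fuel) m
      ≡⟨ conv-cong m (λ k k≤m → cong (hookWeight x k *_) (sum k k≤m)) sum ⟩
    conv (λ k → hookWeight x k * rothe x k) (rothe x) m
      ≡⟨ rothe-recurrence x m ⟨
    rothe x (suc m) ∎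
    where
    open ≡-Reasoning
    sum : ∀ k → k ℕ.≤ m → S (forestsOfSize fuel k) ≡ rothe x k
    sum k k≤m = sumOver-forestsOfSize fuel k (ℕ.≤-<-trans k≤m m<fuel)

theorem4p1 : (n : ℕ) (enum : List PlaneForest) →
    Unique enum →
    ((F : PlaneForest) → (F ∈ enum) ⇔ (forestSize F ≡ n)) →
    (x : ℚ) →
    sumOver (forestProd x) enum
    ≡ ((+ 1) / suc (2 ℕ.* n)) * gbinom (ℕ→ℚ (suc (2 ℕ.* n)) * x) n
theorem4p1 n enum unique members x = begin
  sumOver (forestProd x) enum                         ≡⟨ sumOver-↭ (forestProd x) enum↭forests ⟩
  sumOver (forestProd x) (forestsOfSize (suc n) n)    ≡⟨ sumOver-forestsOfSize x (suc n) n (ℕ.n<1+n n) ⟩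
  Rothe.rothe (x + x) x n                             ≡⟨ rothe≡gbinom x n ⟩
  ((+ 1) / suc (2 ℕ.* n)) * gbinom (ℕ→ℚ (suc (2 ℕ.* n)) * x) n ∎
  where
  open ≡-Reasoning
  enum↭forests : enum ↭ forestsOfSize (suc n) n
  enum↭forests = ∼bag⇒↭ (unique∧set⇒bag unique (forestsOfSize-unique (suc n) n)
    (λ {F} → ⇔.trans (members F) (⇔.sym (∈-forestsOfSize⇔ n))))
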